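{- Let $E$ be a finite set and $\tau:2^{E}\to2^{E}$ an operator satisfying (Convexity) for all $X\subseteq Y\subseteq Z\subseteq E$ with $\tau(X)=\tau(Z)$ we have $\tau(Y)=\tau(X)=\tau(Z)$, and (C3) $\tau(\tau(X))=\tau(X)$ for all $X\subseteq E$. Then $\tau$ satisfies (C22): for all $F\subseteq G\subseteq E$ with $G\subseteq\tau(F)$, $\tau(G)=\tau(F)$. -}

module Submission where

open import Data.Nat using (ℕ)
open import Data.Fin.Subset using (Subset; _⊆_)
open import Relation.Binary.PropositionalEquality using (_≡_; sym)

mainTheorem8 : (n : ℕ) (τ : Subset n → Subset n)
    → (∀ X Y Z → X ⊆ Y → Y ⊆ Z → τ X ≡ τ Z → τ Y ≡ τ X)
    → (∀ X → τ (τ X) ≡ τ X)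
    → ∀ F G → F ⊆ G → G ⊆ τ F → τ G ≡ τ F
mainTheorem8 n τ convex idempotent F G F⊆G G⊆τF =
  convex F G (τ F) F⊆G G⊆τF (sym (idempotent F))
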